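{- Let $G=(V,E)$ be a finite simple graph and let $\mathcal{F}$ be a (possibly empty) collection of forts of $G$. Let $x\in\{0,1\}^V$ and $F'=\{v\in V: x_v=1\}$. Then $F'$ is a fort of $G$ that is minimal with respect to $\mathcal{F}$ (i.e., $F\not\subseteq F'$ for all $F\in\mathcal{F}$) if and only if $x$ satisfies (1) $\sum_{v\in V}x_v\ge1$; (2) $x_u-x_v+\sum_{w\in N(u)\setminus\{v\}}x_w\ge 0$ for all $v\in V$, $u\in N(v)$; (3) $\sum_{v\in F}x_v\le|F|-1$ for all $F\in\mathcal{F}$.
   Context: $N(u)$ is the neighborhood of $u$. A fort of $G$ is a non-empty set $F\subseteq V$ such that no vertex $u\in V\setminus F$ has exactly one neighbor in $F$. -}

module Defs where

open import Data.Bool using (Bool; true; false; _∧_; not; if_then_else_)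
open import Data.Nat using (ℕ; zero; suc)
open import Data.Integer using (ℤ; +_; _+_; _-_; _≤_)
open import Data.Fin using (Fin; zero; suc; _≟_)
open import Data.Fin.Subset using (Subset; _∈_; _∉_; _⊆_; ∣_∣; Nonempty)
open import Data.Vec using (tabulate; lookup)
open import Data.List using (List)
open import Data.List.Relation.Unary.All using (All)
open import Data.List.Membership.Propositional using () renaming (_∈_ to _∈ₗ_)
open import Relation.Binary.PropositionalEquality using (_≡_; _≢_)
open import Relation.Nullary using (¬_)
open import Relation.Nullary.Decidable using (⌊_⌋)
open import Data.Product using (_×_)
open import Data.Sum using (_⊎_)

record SimpleGraph (n : ℕ) : Set where
  field
    adj   : Fin n → Fin n → Bool
    sym   : ∀ u v → adj u v ≡ adj v u
    irrefl : ∀ v → adj v v ≡ false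
open SimpleGraph public

neighborsIn : ∀ {n} → SimpleGraph n → Fin n → Subset n → Subset n
neighborsIn G u F = tabulate (λ w → adj G u w ∧ lookup F w)

IsFort : ∀ {n} → SimpleGraph n → Subset n → Set
IsFort G F = Nonempty F × (∀ u → u ∉ F → ∣ neighborsIn G u F ∣ ≢ 1)

sumOver : ∀ {n} → (Fin n → Bool) → (Fin n → ℤ) → ℤ
sumOver {zero} S f = + 0
sumOver {suc n} S f =
  (if S zero then f zero else (+ 0)) + sumOver (λ i → S (suc i)) (λ i → f (suc i))

sumAll : ∀ {n} → (Fin n → ℤ) → ℤ
sumAll f = sumOver (λ _ → true) f

IsBinary : ∀ {n} → (Fin n → ℤ) → Set
IsBinary x = ∀ v → (x v ≡ + 0) ⊎ (x v ≡ + 1)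

support : ∀ {n} → (Fin n → ℤ) → Subset n
support x = tabulate (λ v → ⌊ x v Data.Integer.≟ + 1 ⌋)

MinimalFortWrt : ∀ {n} → SimpleGraph n → List (Subset n) → Subset n → Set
MinimalFortWrt G 𝓕 F' = IsFort G F' × (∀ F → F ∈ₗ 𝓕 → ¬ (F ⊆ F'))

Cond1 : ∀ {n} → (Fin n → ℤ) → Set
Cond1 x = + 1 ≤ sumAll x

Cond2 : ∀ {n} → SimpleGraph n → (Fin n → ℤ) → Set
Cond2 G x = ∀ v u → adj G v u ≡ true →
  + 0 ≤ (x u - x v) + sumOver (λ w → adj G u w ∧ not ⌊ w ≟ v ⌋) x

Cond3 : ∀ {n} → List (Subset n) → (Fin n → ℤ) → Set
Cond3 𝓕 x = ∀ F → F ∈ₗ 𝓕 → sumOver (lookup F) x ≤ + ∣ F ∣ - + 1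

{-# OPTIONS --safe #-}
module Submission where

-- For a 0/1 vector x with support F′, every sum Σ_{v ∈ S} x_v is |S ∩ F′|.  Hence (1) says
-- F′ ≠ ∅ and (3) says |F ∩ F′| < |F|, i.e. F ⊈ F′.  The left side of (2) for the edge vu is
-- x_u − x_v + |(N(u) ∩ F′) ∖ {v}|, which is negative exactly when u ∉ F′, v ∈ F′ and v is
-- the only neighbour of u in F′; so (2) says that no vertex outside F′ has exactly one
-- neighbour in F′.

open import Defs hiding (sym)
open import Data.Nat using (ℕ)
open import Data.Integer using (ℤ)
open import Data.Fin using (Fin)
open import Data.Fin.Subset using (Subset)
open import Data.List using (List)
open import Data.List.Relation.Unary.All using (All)
open import Data.Product using (_×_)
open import Function.Bundles using (_⇔_)

open import Data.Bool using (Bool; true; false; _∧_; not)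
open import Data.Bool.Properties using (∧-zeroʳ; ∧-identityʳ)
open import Data.Nat using (zero; suc; z≤n; s≤s; _<_)
open import Data.Nat.Properties using (<⇒≱; <⇒≢; suc-injective; ≤-reflexive)
open import Data.Integer as ℤ using (+_; +≤+)
open import Data.Integer.Properties using (drop‿+≤+; +-identityˡ)
open import Data.Fin using (zero; suc; _≟_)
open import Data.Fin.Subset
  using (_∈_; _∉_; _⊈_; _∩_; _─_; _-_; ⁅_⁆; ∣_∣; Nonempty; outside; inside)
open import Data.Fin.Subset.Properties
  using (nonempty?; Empty-unique; ∣⊥∣≡0; ∣p∩q∣≤∣p∣; p⊆q⇒∣p∣≤∣q∣; x∈p∩q⁺; x∈p∩q⁻; out⊆; in⊆in;
         p─⊥≡p)
open import Data.Vec using ([]; _∷_; tabulate; lookup; here; there)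
open import Data.Vec.Properties
  using (lookup∘tabulate; tabulate∘lookup; tabulate-cong; []=⇒lookup; lookup⇒[]=)
open import Data.Product using (_,_)
open import Data.Sum using (_⊎_; inj₁; inj₂)
open import Function using (_∘_; const)
open import Function.Bundles using (mk⇔; Equivalence)
open import Function.Properties.Equivalence using () renaming (trans to ⇔-trans)
open import Relation.Binary.PropositionalEquality
  using (_≡_; _≢_; refl; sym; trans; cong; cong₂; subst; module ≡-Reasoning)
open import Relation.Nullary using (Dec; yes; no; contradiction)
open import Relation.Nullary.Decidable using (⌊_⌋)

open Equivalence using (to; from)

private
  variable
    n : ℕ

⌊⌋≡true⇔ : ∀ {a} {A : Set a} (a? : Dec A) → ⌊ a? ⌋ ≡ true ⇔ A
⌊⌋≡true⇔ (yes a) = mk⇔ (const a) (const refl)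
⌊⌋≡true⇔ (no ¬a) = mk⇔ (λ ()) (λ a → contradiction a ¬a)

-- suc i ≟ suc x is map′ … (i ≟ x), on which ⌊_⌋ does not compute.
⌊suc≟suc⌋ : ∀ (i x : Fin n) → ⌊ suc i ≟ suc x ⌋ ≡ ⌊ i ≟ x ⌋
⌊suc≟suc⌋ i x with i ≟ x
... | yes _ = refl
... | no  _ = refl

∈-tabulate⇔ : ∀ {f : Fin n → Bool} {x} → x ∈ tabulate f ⇔ f x ≡ true
∈-tabulate⇔ {f = f} {x} = mk⇔
  (λ x∈ → trans (sym (lookup∘tabulate f x)) ([]=⇒lookup x∈))
  (λ fx → lookup⇒[]= x (tabulate f) (trans (lookup∘tabulate f x) fx))

tabulate-∧-lookup : ∀ (f : Fin n → Bool) (p : Subset n) →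
                    tabulate (λ i → f i ∧ lookup p i) ≡ tabulate f ∩ p
tabulate-∧-lookup f []      = refl
tabulate-∧-lookup f (b ∷ p) = cong (f zero ∧ b ∷_) (tabulate-∧-lookup (f ∘ suc) p)

tabulate-∧-≢ : ∀ (f : Fin n → Bool) x → tabulate (λ i → f i ∧ not ⌊ i ≟ x ⌋) ≡ tabulate f - x
tabulate-∧-≢ f zero    = cong₂ _∷_ (∧-zeroʳ (f zero))
  (trans (tabulate-cong (∧-identityʳ ∘ f ∘ suc)) (sym (p─⊥≡p (tabulate (f ∘ suc)))))
tabulate-∧-≢ f (suc x) = cong₂ _∷_ (∧-identityʳ (f zero)) (begin
  tabulate (λ i → f (suc i) ∧ not ⌊ suc i ≟ suc x ⌋)
    ≡⟨ tabulate-cong (λ i → cong (λ b → f (suc i) ∧ not b) (⌊suc≟suc⌋ i x)) ⟩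
  tabulate (λ i → f (suc i) ∧ not ⌊ i ≟ x ⌋)
    ≡⟨ tabulate-∧-≢ (f ∘ suc) x ⟩
  tabulate (f ∘ suc) - x ∎)
  where open ≡-Reasoning

[p─r]∩q≡[p∩q]─r : ∀ (p q r : Subset n) → (p ─ r) ∩ q ≡ (p ∩ q) ─ r
[p─r]∩q≡[p∩q]─r []      []      []            = refl
[p─r]∩q≡[p∩q]─r (a ∷ p) (b ∷ q) (inside  ∷ r) = cong (outside ∷_) ([p─r]∩q≡[p∩q]─r p q r)
[p─r]∩q≡[p∩q]─r (a ∷ p) (b ∷ q) (outside ∷ r) = cong (a ∧ b ∷_) ([p─r]∩q≡[p∩q]─r p q r)

x∈p⇒∣p∣≡1+∣p-x∣ : ∀ {p : Subset n} {x} → x ∈ p → ∣ p ∣ ≡ suc ∣ p - x ∣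
x∈p⇒∣p∣≡1+∣p-x∣ {p = inside  ∷ p} here        = cong (suc ∘ ∣_∣) (sym (p─⊥≡p p))
x∈p⇒∣p∣≡1+∣p-x∣ {p = inside  ∷ p} (there x∈p) = cong suc (x∈p⇒∣p∣≡1+∣p-x∣ x∈p)
x∈p⇒∣p∣≡1+∣p-x∣ {p = outside ∷ p} (there x∈p) = x∈p⇒∣p∣≡1+∣p-x∣ x∈p

Nonempty⇔0<∣p∣ : ∀ {p : Subset n} → Nonempty p ⇔ 0 < ∣ p ∣
Nonempty⇔0<∣p∣ {n} {p} = mk⇔ nonempty⇒ ⇒nonempty
  where
  nonempty⇒ : Nonempty p → 0 < ∣ p ∣
  nonempty⇒ (x , x∈p) = subst (0 <_) (sym (x∈p⇒∣p∣≡1+∣p-x∣ x∈p)) (s≤s z≤n)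
  ⇒nonempty : 0 < ∣ p ∣ → Nonempty p
  ⇒nonempty 0<∣p∣ with nonempty? p
  ... | yes ne   = ne
  ... | no empty = contradiction (trans (cong ∣_∣ (Empty-unique empty)) (∣⊥∣≡0 n)) (<⇒≢ 0<∣p∣ ∘ sym)

p⊈q⇔∣p∩q∣<∣p∣ : ∀ {p q : Subset n} → p ⊈ q ⇔ ∣ p ∩ q ∣ < ∣ p ∣
p⊈q⇔∣p∩q∣<∣p∣ {p = p} {q} = mk⇔ (p⊈q⇒∣p∩q∣<∣p∣ p q) ∣p∩q∣<∣p∣⇒p⊈q
  where
  p⊈q⇒∣p∩q∣<∣p∣ : ∀ {n} (p q : Subset n) → p ⊈ q → ∣ p ∩ q ∣ < ∣ p ∣
  p⊈q⇒∣p∩q∣<∣p∣ []            []            p⊈q = contradiction (λ ()) p⊈q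
  p⊈q⇒∣p∩q∣<∣p∣ (outside ∷ p) (_ ∷ q)       p⊈q = p⊈q⇒∣p∩q∣<∣p∣ p q (p⊈q ∘ out⊆)
  p⊈q⇒∣p∩q∣<∣p∣ (inside  ∷ p) (outside ∷ q) _   = s≤s (∣p∩q∣≤∣p∣ p q)
  p⊈q⇒∣p∩q∣<∣p∣ (inside  ∷ p) (inside  ∷ q) p⊈q = s≤s (p⊈q⇒∣p∩q∣<∣p∣ p q (p⊈q ∘ in⊆in))
  ∣p∩q∣<∣p∣⇒p⊈q : ∣ p ∩ q ∣ < ∣ p ∣ → p ⊈ q
  ∣p∩q∣<∣p∣⇒p⊈q lt p⊆q = <⇒≱ lt (p⊆q⇒∣p∣≤∣q∣ (λ x∈p → x∈p∩q⁺ (x∈p , p⊆q x∈p)))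

0<m⇔+1≤+m : ∀ {m} → 0 < m ⇔ + 1 ℤ.≤ + m
0<m⇔+1≤+m = mk⇔ +≤+ drop‿+≤+

m<n⇔+m≤+n-1 : ∀ {m n} → m < n ⇔ + m ℤ.≤ + n ℤ.- + 1
m<n⇔+m≤+n-1 = mk⇔ to′ from′
  where
  to′ : ∀ {m n} → m < n → + m ℤ.≤ + n ℤ.- + 1
  to′ (s≤s m≤n) = +≤+ m≤n
  from′ : ∀ {m n} → + m ℤ.≤ + n ℤ.- + 1 → m < n
  from′ {n = suc n} (+≤+ m≤n) = s≤s m≤n

0≤a-b+k⇔ : ∀ {a b k} → a ≡ + 0 ⊎ a ≡ + 1 → b ≡ + 0 ⊎ b ≡ + 1 →
           + 0 ℤ.≤ (a ℤ.- b) ℤ.+ + k ⇔ (a ≡ + 0 → b ≡ + 1 → k ≢ 0)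
0≤a-b+k⇔ (inj₁ refl) (inj₁ refl)             = mk⇔ (λ _ _ ()) (λ _ → +≤+ z≤n)
0≤a-b+k⇔ {k = zero}  (inj₁ refl) (inj₂ refl) = mk⇔ (λ ()) (λ k≢0 → contradiction refl (k≢0 refl refl))
0≤a-b+k⇔ {k = suc k} (inj₁ refl) (inj₂ refl) = mk⇔ (λ _ _ _ ()) (λ _ → +≤+ z≤n)
0≤a-b+k⇔ (inj₂ refl) (inj₁ refl)             = mk⇔ (λ _ ()) (λ _ → +≤+ z≤n)
0≤a-b+k⇔ (inj₂ refl) (inj₂ refl)             = mk⇔ (λ _ ()) (λ _ → +≤+ z≤n)

sumOver-binary : ∀ {x : Fin n → ℤ} → IsBinary x →
                 ∀ S → sumOver S x ≡ + ∣ tabulate S ∩ support x ∣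
sumOver-binary {zero}  _   S = refl
sumOver-binary {suc n} bin S with S zero | bin zero
... | false | _                    = trans (+-identityˡ _) (sumOver-binary (bin ∘ suc) (S ∘ suc))
... | true  | inj₁ x₀≡0 rewrite x₀≡0 = trans (+-identityˡ _) (sumOver-binary (bin ∘ suc) (S ∘ suc))
... | true  | inj₂ x₀≡1 rewrite x₀≡1 = cong (ℤ._+_ (+ 1)) (sumOver-binary (bin ∘ suc) (S ∘ suc))

∈-neighborsIn⇔ : ∀ (G : SimpleGraph n) {F u v} →
                 v ∈ neighborsIn G u F ⇔ (adj G u v ≡ true × v ∈ F)
∈-neighborsIn⇔ G {F} {u} {v} = mk⇔
  (λ v∈ → let (v∈N , v∈F) = x∈p∩q⁻ _ F (subst (v ∈_) neighborsIn≡ v∈) in to ∈-tabulate⇔ v∈N , v∈F)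
  (λ (u~v , v∈F) → subst (v ∈_) (sym neighborsIn≡) (x∈p∩q⁺ (from ∈-tabulate⇔ u~v , v∈F)))
  where
  neighborsIn≡ : neighborsIn G u F ≡ tabulate (adj G u) ∩ F
  neighborsIn≡ = tabulate-∧-lookup (adj G u) F

∈-support⇔ : ∀ {x : Fin n → ℤ} {v} → v ∈ support x ⇔ x v ≡ + 1
∈-support⇔ {x = x} {v} = ⇔-trans ∈-tabulate⇔ (⌊⌋≡true⇔ (x v ℤ.≟ + 1))

module _ {x : Fin n → ℤ} (bin : IsBinary x) where

  ∉-support⇔ : ∀ {v} → v ∉ support x ⇔ x v ≡ + 0
  ∉-support⇔ {v} =
    mk⇔ ∉⇒≡0 (λ xv≡0 v∈ → contradiction (trans (sym xv≡0) (to ∈-support⇔ v∈)) λ ())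
    where
    ∉⇒≡0 : v ∉ support x → x v ≡ + 0
    ∉⇒≡0 v∉ with bin v
    ... | inj₁ xv≡0 = xv≡0
    ... | inj₂ xv≡1 = contradiction (from ∈-support⇔ xv≡1) v∉

  Nonempty⇔Cond1 : Nonempty (support x) ⇔ Cond1 x
  Nonempty⇔Cond1 = subst (λ s → Nonempty (support x) ⇔ + 1 ℤ.≤ s) (sym sumAll≡)
                         (⇔-trans Nonempty⇔0<∣p∣ 0<m⇔+1≤+m)
    where
    ⊤∩F′≡F′ : tabulate (const true) ∩ support x ≡ support x
    ⊤∩F′≡F′ = trans (sym (tabulate-∧-lookup (const true) (support x))) (tabulate∘lookup (support x))
    sumAll≡ : sumAll x ≡ + ∣ support x ∣
    sumAll≡ = trans (sumOver-binary bin (const true)) (cong (+_ ∘ ∣_∣) ⊤∩F′≡F′)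

  ⊈-support⇔ : ∀ F → F ⊈ support x ⇔ sumOver (lookup F) x ℤ.≤ + ∣ F ∣ ℤ.- + 1
  ⊈-support⇔ F = subst (λ s → F ⊈ support x ⇔ s ℤ.≤ + ∣ F ∣ ℤ.- + 1) (sym sumOver≡)
                       (⇔-trans p⊈q⇔∣p∩q∣<∣p∣ m<n⇔+m≤+n-1)
    where
    sumOver≡ : sumOver (lookup F) x ≡ + ∣ F ∩ support x ∣
    sumOver≡ = trans (sumOver-binary bin (lookup F))
                     (cong (λ p → + ∣ p ∩ support x ∣) (tabulate∘lookup F))

  module _ (G : SimpleGraph n) where

    sumOver-neighbors-but : ∀ u v →
      sumOver (λ w → adj G u w ∧ not ⌊ w ≟ v ⌋) x ≡ + ∣ neighborsIn G u (support x) - v ∣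
    sumOver-neighbors-but u v = begin
      sumOver (λ w → adj G u w ∧ not ⌊ w ≟ v ⌋) x
        ≡⟨ sumOver-binary bin _ ⟩
      + ∣ tabulate (λ w → adj G u w ∧ not ⌊ w ≟ v ⌋) ∩ support x ∣
        ≡⟨ cong (λ p → + ∣ p ∩ support x ∣) (tabulate-∧-≢ (adj G u) v) ⟩
      + ∣ (tabulate (adj G u) - v) ∩ support x ∣
        ≡⟨ cong (+_ ∘ ∣_∣) ([p─r]∩q≡[p∩q]─r (tabulate (adj G u)) (support x) ⁅ v ⁆) ⟩
      + ∣ tabulate (adj G u) ∩ support x - v ∣
        ≡⟨ cong (λ p → + ∣ p - v ∣) (sym (tabulate-∧-lookup (adj G u) (support x))) ⟩
      + ∣ neighborsIn G u (support x) - v ∣ ∎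
      where open ≡-Reasoning

    Cond2-at⇔ : ∀ v u →
      + 0 ℤ.≤ (x u ℤ.- x v) ℤ.+ sumOver (λ w → adj G u w ∧ not ⌊ w ≟ v ⌋) x
        ⇔ (x u ≡ + 0 → x v ≡ + 1 → ∣ neighborsIn G u (support x) - v ∣ ≢ 0)
    Cond2-at⇔ v u rewrite sumOver-neighbors-but u v = 0≤a-b+k⇔ (bin u) (bin v)

    closed⇔Cond2 : (∀ u → u ∉ support x → ∣ neighborsIn G u (support x) ∣ ≢ 1) ⇔ Cond2 G x
    closed⇔Cond2 = mk⇔ closed⇒Cond2 Cond2⇒closed
      where
      closed⇒Cond2 : (∀ u → u ∉ support x → ∣ neighborsIn G u (support x) ∣ ≢ 1) → Cond2 G x
      closed⇒Cond2 closed v u v~u = from (Cond2-at⇔ v u) v-not-alone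
        where
        v-not-alone : x u ≡ + 0 → x v ≡ + 1 → ∣ neighborsIn G u (support x) - v ∣ ≢ 0
        v-not-alone xu≡0 xv≡1 ∣N-v∣≡0 = closed u (from ∉-support⇔ xu≡0) (begin
          ∣ neighborsIn G u (support x) ∣         ≡⟨ x∈p⇒∣p∣≡1+∣p-x∣ v∈N ⟩
          suc ∣ neighborsIn G u (support x) - v ∣ ≡⟨ cong suc ∣N-v∣≡0 ⟩
          1                                       ∎)
          where
          open ≡-Reasoning
          v∈N : v ∈ neighborsIn G u (support x)
          v∈N = from (∈-neighborsIn⇔ G) (trans (SimpleGraph.sym G u v) v~u , from ∈-support⇔ xv≡1)

      Cond2⇒closed : Cond2 G x → ∀ u → u ∉ support x → ∣ neighborsIn G u (support x) ∣ ≢ 1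
      Cond2⇒closed c2 u u∉ ∣N∣≡1 =
        let (v , v∈N)    = from Nonempty⇔0<∣p∣ (≤-reflexive (sym ∣N∣≡1))
            (u~v , v∈F′) = to (∈-neighborsIn⇔ G) v∈N
        in to (Cond2-at⇔ v u) (c2 v u (trans (SimpleGraph.sym G v u) u~v))
              (to ∉-support⇔ u∉) (to ∈-support⇔ v∈F′)
              (suc-injective (trans (sym (x∈p⇒∣p∣≡1+∣p-x∣ v∈N)) ∣N∣≡1))

lemma6p1 : ∀ {n} (G : SimpleGraph n) (𝓕 : List (Subset n)) → All (IsFort G) 𝓕 →
           (x : Fin n → ℤ) → IsBinary x →
           MinimalFortWrt G 𝓕 (support x) ⇔ (Cond1 x × Cond2 G x × Cond3 𝓕 x)
lemma6p1 G 𝓕 _ x bin = mk⇔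
  (λ ((nonempty , closed) , minimal) →
     to (Nonempty⇔Cond1 bin) nonempty , to (closed⇔Cond2 bin G) closed ,
     λ F F∈𝓕 → to (⊈-support⇔ bin F) (minimal F F∈𝓕))
  (λ (cond1 , cond2 , cond3) →
     (from (Nonempty⇔Cond1 bin) cond1 , from (closed⇔Cond2 bin G) cond2) ,
     λ F F∈𝓕 → from (⊈-support⇔ bin F) (cond3 F F∈𝓕))
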